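{- For all positive integers $n,m,k$, $Z_{\mathsf{SR}}(m,n;k,k)\le 2(m+n)(k-1)$.
   Context: A bipartite graph $G=(U\cup V,E)$ is a segment-ray graph (class $\mathsf{SR}$) if there is a map sending each $u\in U$ to a horizontal segment in $\mathbb{R}^2$ and each $v\in V$ to a vertical upward ray $\{x\}\times[y,\infty)$ such that $uv\in E$ iff they intersect. $Z_{\mathcal{C}}(m,n;k,k)$ is the maximum number of edges of a graph $G=(U\cup V,E)\in\mathcal{C}$ with $|U|=m$, $|V|=n$ not containing $K_{k,k}$ as a subgraph.
   Formalization: The horizontal segments and vertical upward rays representing a segment-ray graph have rational coordinates rather than real ones in $\mathbb{R}^2$. -}

module Defs where

open import Data.Nat using (ℕ; _+_; _*_)
open import Data.Fin using (Fin)
open import Data.Fin.Base using ()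
open import Data.List using (List; map; allFin)
open import Data.Nat.ListAction using (sum)
open import Data.Bool using (Bool; true; false; if_then_else_)
open import Data.Rational using (ℚ; _≤_)
open import Data.Product using (Σ; _×_; ∃-syntax)
open import Function.Bundles using (_⇔_)
open import Function.Definitions using (Injective)
open import Relation.Binary.PropositionalEquality using (_≡_)

BipGraph : ℕ → ℕ → Set
BipGraph m n = Fin m → Fin n → Bool

edgeCount : ∀ {m n} → BipGraph m n → ℕ
edgeCount {m} {n} E =
  sum (map (λ u → sum (map (λ v → if E u v then 1 else 0) (allFin n))) (allFin m))

record HSeg : Set where
  constructor hseg
  field
    left right height : ℚ
    left≤right : left ≤ right

-- Vertical upward ray {xpos} × [base, ∞).
record URay : Set where
  constructor uray
  field
    xpos base : ℚ

Meets : HSeg → URay → Set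
Meets s r = (HSeg.left s ≤ URay.xpos r × URay.xpos r ≤ HSeg.right s)
            × URay.base r ≤ HSeg.height s

IsSR : ∀ {m n} → BipGraph m n → Set
IsSR {m} {n} E =
  Σ (Fin m → HSeg) λ σ → Σ (Fin n → URay) λ ρ →
    ∀ u v → (E u v ≡ true) ⇔ Meets (σ u) (ρ v)

ContainsKkk : ∀ {m n} → ℕ → BipGraph m n → Set
ContainsKkk {m} {n} k E =
  Σ (Fin k → Fin m) λ f → Σ (Fin k → Fin n) λ g →
    Injective _≡_ _≡_ f × Injective _≡_ _≡_ g × (∀ i j → E (f i) (g j) ≡ true)

{-# OPTIONS --safe #-}
module Submission where

-- If segment u crosses ray v, every segment through v reaching at least as far
-- right as u crosses every ray through u lying right of v and no higher than v
-- (and symmetrically on the left). So in a K_{k,k}-free graph each edge uv has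
-- fewer than k segments of one of these two kinds, or fewer than k rays of
-- both kinds. Looking at an extremal such edge, a ray carries at most 2(k-1)
-- edges of the first sort and a segment at most 2(k-1) of the second; double
-- counting gives the bound.

open import Defs
open import Data.Nat
  using (ℕ; zero; suc; _+_; _*_; _∸_; _≤_; _<_; _<?_; z≤n; s≤s; s≤s⁻¹; NonZero)
open import Data.Nat.Properties
  using ( ≤-refl; ≤-reflexive; ≤-trans; +-mono-≤; +-0-commutativeMonoid; ≰⇒>; ≮⇒≥
        ; suc[m]≤n⇒m≤pred[n]; module ≤-Reasoning)
open import Data.Nat.Solver using (module +-*-Solver)
import Data.Nat.ListAction as List
open import Algebra.Properties.CommutativeMonoid.Sum +-0-commutativeMonoid
  using (sum-syntax; sum-cong-≗; ∑-comm; ∑-distrib-+)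
open import Data.Fin using (Fin; zero; suc; lift)
open import Data.Fin.Properties using (lift-injective; suc-injective)
open import Data.List using (allFin; tabulate; map)
open import Data.List.Properties using (map-tabulate)
open import Data.Bool using (Bool; true; false; if_then_else_; _≟_)
open import Data.Rational using () renaming (_≤_ to _≤ℚ_)
open import Data.Rational.Properties
  using () renaming (_≤?_ to _≤ℚ?_; ≤-trans to ≤ℚ-trans; ≤-total to ≤ℚ-total)
open import Data.Product using (_×_; _,_; ∃-syntax)
open import Data.Sum using (_⊎_; inj₁; inj₂; [_,_]′)
open import Data.Empty using (⊥-elim)
open import Function using (id; _∘_; Injective; Equivalence)
open import Function.Bundles using (_⇔_)
open import Level using (Level; 0ℓ)
open import Relation.Binary using (Rel; Reflexive; Total; Transitive)
open import Relation.Binary.PropositionalEquality using (_≡_; refl; cong; trans)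
open import Relation.Nullary using (¬_; Dec; yes; no)
open import Relation.Nullary.Decidable using (_×-dec_; _⊎-dec_)
open import Relation.Unary using (Pred; Decidable; Empty; _⊆_; _∪_)

private
  variable
    ℓ ℓ′ ℓ₁ ℓ₂ ℓ₃ : Level
    A : Set ℓ₁
    B : Set ℓ₂
    C : Set ℓ₃
    N k : ℕ

indicator : Dec A → ℕ
indicator (yes _) = 1
indicator (no _)  = 0

indicator-mono : (A → B) → (a? : Dec A) (b? : Dec B) → indicator a? ≤ indicator b?
indicator-mono _ (no _)  _       = z≤n
indicator-mono _ (yes _) (yes _) = ≤-refl
indicator-mono f (yes a) (no ¬b) = ⊥-elim (¬b (f a))

indicator-⊎ : (A → B ⊎ C) → (a? : Dec A) (b? : Dec B) (c? : Dec C) →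
              indicator a? ≤ indicator b? + indicator c?
indicator-⊎ _ (no _)  _        _       = z≤n
indicator-⊎ _ (yes _) (yes _)  _       = s≤s z≤n
indicator-⊎ _ (yes _) (no _)   (yes _) = s≤s z≤n
indicator-⊎ f (yes a) (no ¬b)  (no ¬c) = ⊥-elim ([ ¬b , ¬c ]′ (f a))

∑-mono-≤ : {f g : Fin N → ℕ} → (∀ i → f i ≤ g i) → ∑[ i < N ] f i ≤ ∑[ i < N ] g i
∑-mono-≤ {zero}  _   = z≤n
∑-mono-≤ {suc N} f≤g = +-mono-≤ (f≤g zero) (∑-mono-≤ (f≤g ∘ suc))

∑-≤-* : ∀ {f : Fin N → ℕ} c → (∀ i → f i ≤ c) → ∑[ i < N ] f i ≤ N * c
∑-≤-* {zero}  _ _   = z≤n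
∑-≤-* {suc N} c f≤c = +-mono-≤ (f≤c zero) (∑-≤-* c (f≤c ∘ suc))

sum-tabulate : (f : Fin N → ℕ) → List.sum (tabulate f) ≡ ∑[ i < N ] f i
sum-tabulate {zero}  f = refl
sum-tabulate {suc N} f = cong (f zero +_) (sum-tabulate (f ∘ suc))

sum-map-allFin : (f : Fin N → ℕ) → List.sum (map f (allFin N)) ≡ ∑[ i < N ] f i
sum-map-allFin f = trans (cong List.sum (map-tabulate (λ i → i) f)) (sum-tabulate f)

count : {P : Pred (Fin N) ℓ} → Decidable P → ℕ
count {N} P? = ∑[ i < N ] indicator (P? i)

module _ {P : Pred (Fin N) ℓ} where

  count-mono : {Q : Pred (Fin N) ℓ′} → P ⊆ Q → (P? : Decidable P) (Q? : Decidable Q) →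
               count P? ≤ count Q?
  count-mono P⊆Q P? Q? = ∑-mono-≤ (λ i → indicator-mono P⊆Q (P? i) (Q? i))

  count-⊆-∪ : {Q R : Pred (Fin N) ℓ′} → P ⊆ Q ∪ R →
              (P? : Decidable P) (Q? : Decidable Q) (R? : Decidable R) →
              count P? ≤ count Q? + count R?
  count-⊆-∪ P⊆Q∪R P? Q? R? = ≤-trans
    (∑-mono-≤ (λ i → indicator-⊎ P⊆Q∪R (P? i) (Q? i) (R? i)))
    (≤-reflexive (∑-distrib-+ (indicator ∘ Q?) (indicator ∘ R?)))

count-empty : {P : Pred (Fin N) ℓ} (P? : Decidable P) → Empty P → count P? ≡ 0
count-empty {zero}  P? _ = refl
count-empty {suc N} P? ∅P with P? zero
... | yes p = ⊥-elim (∅P zero p)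
... | no _  = count-empty (P? ∘ suc) (∅P ∘ suc)

≤count⇒injection : {P : Pred (Fin N) ℓ} (P? : Decidable P) → k ≤ count P? →
                   ∃[ f ] Injective _≡_ _≡_ f × (∀ (i : Fin k) → P (f i))
≤count⇒injection {k = zero}          _  _ = (λ ()) , (λ {}) , (λ ())
≤count⇒injection {zero}  {k = suc k} _  ()
≤count⇒injection {suc N} {k = suc k} P? k≤count with P? zero
... | yes p with f , f-inj , Pf ← ≤count⇒injection (P? ∘ suc) (s≤s⁻¹ k≤count) =
  lift 1 f , lift-injective f f-inj 1 , λ { zero → p ; (suc i) → Pf i }
... | no _ with f , f-inj , Pf ← ≤count⇒injection (P? ∘ suc) k≤count =
  suc ∘ f , f-inj ∘ suc-injective , Pf

total⇒reflexive : {_≼_ : Rel A ℓ} → Total _≼_ → Reflexive _≼_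
total⇒reflexive total {x} = [ id , id ]′ (total x x)

minimal-or-empty : {_≼_ : Rel (Fin N) ℓ′} → Total _≼_ → Transitive _≼_ →
                   {P : Pred (Fin N) ℓ} → Decidable P →
                   Empty P ⊎ ∃[ j ] P j × (∀ {i} → P i → j ≼ i)
minimal-or-empty {zero} _ _ _ = inj₁ (λ ())
minimal-or-empty {suc N} total trans P?
  with minimal-or-empty (λ i j → total (suc i) (suc j)) trans (P? ∘ suc) | P? zero
... | inj₁ ∅P | no ¬p = inj₁ λ { zero → ¬p ; (suc i) → ∅P i }
... | inj₁ ∅P | yes p =
  inj₂ (zero , p , λ { {zero} _ → total⇒reflexive total ; {suc i} q → ⊥-elim (∅P i q) })
... | inj₂ (j , q , j-min) | no ¬p =
  inj₂ (suc j , q , λ { {zero} p → ⊥-elim (¬p p) ; {suc i} → j-min })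
... | inj₂ (j , q , j-min) | yes p with total zero (suc j)
...   | inj₁ 0≼j =
  inj₂ (zero , p , λ { {zero} _ → total⇒reflexive total ; {suc i} r → trans 0≼j (j-min r) })
...   | inj₂ j≼0 = inj₂ (suc j , q , λ { {zero} _ → j≼0 ; {suc i} → j-min })

count-≤-via-minimal : {_≼_ : Rel (Fin N) ℓ′} → Total _≼_ → Transitive _≼_ →
                      {P : Pred (Fin N) ℓ} {R : Fin N → Pred (Fin N) ℓ}
                      (P? : Decidable P) (R? : ∀ j → Decidable (R j)) →
                      (∀ {j i} → P j → P i → j ≼ i → R j i) →
                      ∀ {c} → (∀ {j} → P j → count (R? j) ≤ c) → count P? ≤ c
count-≤-via-minimal total trans P? R? above⊆R count-R≤c
  with minimal-or-empty total trans P?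
... | inj₁ ∅P = ≤-trans (≤-reflexive (count-empty P? ∅P)) z≤n
... | inj₂ (j , p , j-min) =
  ≤-trans (count-mono (λ q → above⊆R p q (j-min q)) P? (R? j)) (count-R≤c p)

if-true≡indicator : ∀ (b : Bool) → (if b then 1 else 0) ≡ indicator (b ≟ true)
if-true≡indicator true  = refl
if-true≡indicator false = refl

edgeCount≡∑count : ∀ {m n} (E : BipGraph m n) →
                   edgeCount E ≡ ∑[ u < m ] count (λ v → E u v ≟ true)
edgeCount≡∑count {m} {n} E = trans (sum-map-allFin {m} _) (sum-cong-≗ λ u →
  trans (sum-map-allFin {n} _) (sum-cong-≗ λ v → if-true≡indicator (E u v)))

large-biclique⇒ContainsKkk : ∀ {m n} (E : BipGraph m n)
                             {X : Pred (Fin m) ℓ} {Y : Pred (Fin n) ℓ′}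
                             (X? : Decidable X) (Y? : Decidable Y) →
                             k ≤ count X? → k ≤ count Y? →
                             (∀ {u v} → X u → Y v → E u v ≡ true) → ContainsKkk k E
large-biclique⇒ContainsKkk E X? Y? k≤X k≤Y X×Y⊆E
  with f , f-inj , Xf ← ≤count⇒injection X? k≤X
     | g , g-inj , Yg ← ≤count⇒injection Y? k≤Y =
  f , g , f-inj , g-inj , λ i j → X×Y⊆E (Xf i) (Yg j)

open HSeg
open URay

meets-lower-right : ∀ {s t r q} → Meets t r → right s ≤ℚ right t →
                    Meets s q → xpos r ≤ℚ xpos q → base q ≤ℚ base r → Meets t q
meets-lower-right ((lt≤xr , _) , br≤ht) rs≤rt ((_ , xq≤rs) , _) xr≤xq bq≤br =
  (≤ℚ-trans lt≤xr xr≤xq , ≤ℚ-trans xq≤rs rs≤rt) , ≤ℚ-trans bq≤br br≤ht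

meets-lower-left : ∀ {s t r q} → Meets t r → left t ≤ℚ left s →
                   Meets s q → xpos q ≤ℚ xpos r → base q ≤ℚ base r → Meets t q
meets-lower-left ((_ , xr≤rt) , br≤ht) lt≤ls ((ls≤xq , _) , _) xq≤xr bq≤br =
  (≤ℚ-trans lt≤ls ls≤xq , ≤ℚ-trans xq≤xr xr≤rt) , ≤ℚ-trans bq≤br br≤ht

module SegmentRay {m n} (k : ℕ) (E : BipGraph m n)
                  (σ : Fin m → HSeg) (ρ : Fin n → URay)
                  (realises : ∀ u v → (E u v ≡ true) ⇔ Meets (σ u) (ρ v))
                  (K-free : ¬ ContainsKkk k E) where

  Adj : Fin m → Fin n → Set
  Adj u v = E u v ≡ true

  adj? : ∀ u → Decidable (Adj u)
  adj? u v = E u v ≟ true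

  meets : ∀ {u v} → Adj u v → Meets (σ u) (ρ v)
  meets {u} {v} = Equivalence.to (realises u v)

  adj : ∀ {u v} → Meets (σ u) (ρ v) → Adj u v
  adj {u} {v} = Equivalence.from (realises u v)

  RightCover LeftCover : Fin m → Fin n → Pred (Fin m) 0ℓ
  RightCover u v t = Adj t v × right (σ u) ≤ℚ right (σ t)
  LeftCover  u v t = Adj t v × left (σ t) ≤ℚ left (σ u)

  Lower LowerRight LowerLeft : Fin m → Fin n → Pred (Fin n) 0ℓ
  Lower      u v r = Adj u r × base (ρ r) ≤ℚ base (ρ v)
  LowerRight u v r = Adj u r × xpos (ρ v) ≤ℚ xpos (ρ r) × base (ρ r) ≤ℚ base (ρ v)
  LowerLeft  u v r = Adj u r × xpos (ρ r) ≤ℚ xpos (ρ v) × base (ρ r) ≤ℚ base (ρ v)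

  rightCover? : ∀ u v → Decidable (RightCover u v)
  rightCover? u v t = adj? t v ×-dec right (σ u) ≤ℚ? right (σ t)

  leftCover? : ∀ u v → Decidable (LeftCover u v)
  leftCover? u v t = adj? t v ×-dec left (σ t) ≤ℚ? left (σ u)

  lower? : ∀ u v → Decidable (Lower u v)
  lower? u v r = adj? u r ×-dec base (ρ r) ≤ℚ? base (ρ v)

  lowerRight? : ∀ u v → Decidable (LowerRight u v)
  lowerRight? u v r = adj? u r ×-dec xpos (ρ v) ≤ℚ? xpos (ρ r) ×-dec base (ρ r) ≤ℚ? base (ρ v)

  lowerLeft? : ∀ u v → Decidable (LowerLeft u v)
  lowerLeft? u v r = adj? u r ×-dec xpos (ρ r) ≤ℚ? xpos (ρ v) ×-dec base (ρ r) ≤ℚ? base (ρ v)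

  right-biclique : ∀ {u v} → k ≤ count (rightCover? u v) → k ≤ count (lowerRight? u v) →
                   ContainsKkk k E
  right-biclique {u} {v} k≤right k≤lower =
    large-biclique⇒ContainsKkk E (rightCover? u v) (lowerRight? u v) k≤right k≤lower
    λ {t} {r} (tv , ru≤rt) (ur , xv≤xr , br≤bv) →
      adj (meets-lower-right {σ u} {σ t} {ρ v} {ρ r} (meets tv) ru≤rt (meets ur) xv≤xr br≤bv)

  left-biclique : ∀ {u v} → k ≤ count (leftCover? u v) → k ≤ count (lowerLeft? u v) →
                  ContainsKkk k E
  left-biclique {u} {v} k≤left k≤lower =
    large-biclique⇒ContainsKkk E (leftCover? u v) (lowerLeft? u v) k≤left k≤lower
    λ {t} {r} (tv , lt≤lu) (ur , xr≤xv , br≤bv) →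
      adj (meets-lower-left {σ u} {σ t} {ρ v} {ρ r} (meets tv) lt≤lu (meets ur) xr≤xv br≤bv)

  FewRight FewLeft FewSide FewLower : Fin m → Fin n → Set
  FewRight u v = Adj u v × count (rightCover? u v) < k
  FewLeft  u v = Adj u v × count (leftCover? u v) < k
  FewSide  u v = FewRight u v ⊎ FewLeft u v
  FewLower u v = Adj u v × count (lowerRight? u v) < k × count (lowerLeft? u v) < k

  fewRight? : ∀ u v → Dec (FewRight u v)
  fewRight? u v = adj? u v ×-dec count (rightCover? u v) <? k

  fewLeft? : ∀ u v → Dec (FewLeft u v)
  fewLeft? u v = adj? u v ×-dec count (leftCover? u v) <? k

  fewSide? : ∀ u v → Dec (FewSide u v)
  fewSide? u v = fewRight? u v ⊎-dec fewLeft? u v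

  fewLower? : ∀ u v → Dec (FewLower u v)
  fewLower? u v = adj? u v ×-dec count (lowerRight? u v) <? k ×-dec count (lowerLeft? u v) <? k

  edge-classes : ∀ {u v} → Adj u v → FewSide u v ⊎ FewLower u v
  edge-classes {u} {v} uv with count (rightCover? u v) <? k | count (leftCover? u v) <? k
  ... | yes few-right | _            = inj₁ (inj₁ (uv , few-right))
  ... | no _          | yes few-left = inj₁ (inj₂ (uv , few-left))
  ... | no many-right | no many-left = inj₂ (uv ,
    ≰⇒> (K-free ∘ right-biclique (≮⇒≥ many-right)) ,
    ≰⇒> (K-free ∘ left-biclique (≮⇒≥ many-left)))

  fewRight-at-ray : ∀ v → count (λ u → fewRight? u v) ≤ k ∸ 1
  fewRight-at-ray v = count-≤-via-minimal
    (λ u t → ≤ℚ-total (right (σ u)) (right (σ t))) ≤ℚ-trans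
    (λ u → fewRight? u v) (λ u → rightCover? u v)
    (λ _ (tv , _) ru≤rt → tv , ru≤rt) (λ (_ , few) → suc[m]≤n⇒m≤pred[n] few)

  fewLeft-at-ray : ∀ v → count (λ u → fewLeft? u v) ≤ k ∸ 1
  fewLeft-at-ray v = count-≤-via-minimal
    (λ u t → ≤ℚ-total (left (σ t)) (left (σ u))) (λ u≼t t≼s → ≤ℚ-trans t≼s u≼t)
    (λ u → fewLeft? u v) (λ u → leftCover? u v)
    (λ _ (tv , _) lt≤lu → tv , lt≤lu) (λ (_ , few) → suc[m]≤n⇒m≤pred[n] few)

  fewSide-at-ray : ∀ v → count (λ u → fewSide? u v) ≤ (k ∸ 1) + (k ∸ 1)
  fewSide-at-ray v = ≤-trans
    (count-⊆-∪ id (λ u → fewSide? u v) (λ u → fewRight? u v) (λ u → fewLeft? u v))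
    (+-mono-≤ (fewRight-at-ray v) (fewLeft-at-ray v))

  Lower⊆LowerRight∪LowerLeft : ∀ {u v} → Lower u v ⊆ LowerRight u v ∪ LowerLeft u v
  Lower⊆LowerRight∪LowerLeft {u} {v} {r} (ur , br≤bv) with ≤ℚ-total (xpos (ρ v)) (xpos (ρ r))
  ... | inj₁ xv≤xr = inj₁ (ur , xv≤xr , br≤bv)
  ... | inj₂ xr≤xv = inj₂ (ur , xr≤xv , br≤bv)

  fewLower-at-segment : ∀ u → count (fewLower? u) ≤ (k ∸ 1) + (k ∸ 1)
  fewLower-at-segment u = count-≤-via-minimal
    (λ v w → ≤ℚ-total (base (ρ w)) (base (ρ v))) (λ v≼w w≼r → ≤ℚ-trans w≼r v≼w)
    (fewLower? u) (lower? u)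
    (λ _ (uw , _) bw≤bv → uw , bw≤bv)
    (λ {v} (_ , few-right , few-left) → ≤-trans
      (count-⊆-∪ Lower⊆LowerRight∪LowerLeft (lower? u v) (lowerRight? u v) (lowerLeft? u v))
      (+-mono-≤ (suc[m]≤n⇒m≤pred[n] few-right) (suc[m]≤n⇒m≤pred[n] few-left)))

n*[c+c]+m*[c+c]≡2*[m+n]*c : ∀ m n c → n * (c + c) + m * (c + c) ≡ 2 * (m + n) * c
n*[c+c]+m*[c+c]≡2*[m+n]*c = solve 3
  (λ m n c → n :* (c :+ c) :+ m :* (c :+ c) := con 2 :* (m :+ n) :* c) refl
  where open +-*-Solver

theorem12 : (m n k : ℕ) → .{{_ : NonZero m}} → .{{_ : NonZero n}} → .{{_ : NonZero k}} →
    (E : BipGraph m n) → IsSR E → ¬ ContainsKkk k E →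
      edgeCount E ≤ 2 * (m + n) * (k ∸ 1)
theorem12 m n k E (σ , ρ , realises) K-free = begin
  edgeCount E
    ≡⟨ edgeCount≡∑count E ⟩
  ∑[ u < m ] count (adj? u)
    ≤⟨ ∑-mono-≤ (λ u → count-⊆-∪ edge-classes (adj? u) (fewSide? u) (fewLower? u)) ⟩
  ∑[ u < m ] (count (fewSide? u) + count (fewLower? u))
    ≡⟨ ∑-distrib-+ (count ∘ fewSide?) (count ∘ fewLower?) ⟩
  ∑[ u < m ] count (fewSide? u) + ∑[ u < m ] count (fewLower? u)
    ≡⟨ cong (_+ ∑[ u < m ] count (fewLower? u)) (∑-comm (λ u v → indicator (fewSide? u v))) ⟩
  ∑[ v < n ] count (λ u → fewSide? u v) + ∑[ u < m ] count (fewLower? u)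
    ≤⟨ +-mono-≤ (∑-≤-* (c + c) fewSide-at-ray) (∑-≤-* (c + c) fewLower-at-segment) ⟩
  n * (c + c) + m * (c + c)
    ≡⟨ n*[c+c]+m*[c+c]≡2*[m+n]*c m n c ⟩
  2 * (m + n) * c ∎
  where
  open ≤-Reasoning
  open SegmentRay k E σ ρ realises K-free
  c : ℕ
  c = k ∸ 1
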